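{- Let $S = S_1 \bowtie_{{\tt H},{\tt K}} S_2$ be the composition of communicating systems $S_1$ and $S_2$ (with disjoint role sets $\mathbf{P}_1,\mathbf{P}_2$) with respect to roles ${\tt H}\in\mathbf{P}_1$, ${\tt K}\in\mathbf{P}_2$ with $M^1_{\tt H}\leftrightarrow M^2_{\tt K}$, and let $M_{\tt H}=(Q_{\tt H}\cup\widehat{Q_{\tt H}},\ldots,\delta_{\tt H})$, $M_{\tt K}=(Q_{\tt K}\cup\widehat{Q_{\tt K}},\ldots,\delta_{\tt K})$ be the gateway machines of $S$. Let $s=(\vec q,\vec\varepsilon)\in RS(S)$ be a reachable configuration with all channels empty such that $q_{\tt H}\notin\widehat{Q_{\tt H}}$, $q_{\tt K}\notin\widehat{Q_{\tt K}}$, and $q_{\tt H}$ and $q_{\tt K}$ are not final. Then either (a) all transitions from $q_{\tt H}$ in $\delta_{\tt H}$ are of the form $(q_{\tt H},{\tt K}{\tt H}?a,q')$ and all transitions from $q_{\tt K}$ in $\delta_{\tt K}$ are of the form $(q_{\tt K},\mathtt{s}{\tt K}?a,q')$ with $\mathtt{s}\neq{\tt H}$; or (b) all transitions from $q_{\tt K}$ in $\delta_{\tt K}$ are of the form $(q_{\tt K},{\tt H}{\tt K}?a,q')$ and all transitions from $q_{\tt H}$ in $\delta_{\tt H}$ are of the form $(q_{\tt H},\mathtt{s}{\tt H}?a,q')$ with $\mathtt{s}\neq{\tt K}$.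
   Context: A CFSM over finite sets $\mathbf{P}$ of roles and $\mathbb{A}$ of messages is $M=(Q,q_0,\mathbb{A},\delta)$ with $Q$ finite, $q_0\in Q$, $\delta\subseteq Q\times Act\times Q$, where $Act=C_\mathbf{P}\times\{!,?\}\times\mathbb{A}$ and $C_\mathbf{P}=\{\mathtt{p}\mathtt{q}\mid \mathtt{p},\mathtt{q}\in\mathbf{P},\mathtt{p}\neq\mathtt{q}\}$ is the set of channels. Label $\mathtt{s}\mathtt{r}!a$ means $\mathtt{s}$ sends $a$ on channel $\mathtt{s}\mathtt{r}$; $\mathtt{s}\mathtt{r}?a$ means $\mathtt{r}$ consumes $a$ from channel $\mathtt{s}\mathtt{r}$. $\mathcal{L}(M)\subseteq Act^*$ is the language of $M$ with all states accepting. A state is final if it has no outgoing transition, sending (resp. receiving) if all its outgoing transitions are labelled by sending (resp. receiving) actions, mixed otherwise. $M$ is ?-deterministic if for every state $q$, $(q,\mathtt{r}\mathtt{s}?a,q'),(q,\mathtt{p}\mathtt{q}?a,q'')\in\delta$ imply $q'=q''$; !-deterministic analogously for sends; ?!-deterministic if both. A communicating system over $\mathbf{P},\mathbb{A}$ is $S=(M_\mathtt{p})_{\mathtt{p}\in\mathbf{P}}$ with $M_\mathtt{p}=(Q_\mathtt{p},q_{0\mathtt{p}},\mathbb{A},\delta_\mathtt{p})$. A configuration is $s=(\vec q,\vec w)$ with $q_\mathtt{p}\in Q_\mathtt{p}$ for each $\mathtt{p}$ and $w_{\mathtt{p}\mathtt{q}}\in\mathbb{A}^*$ for each channel; the initial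 configuration has all initial states and empty channels ($\vec\varepsilon$ denotes all channels empty). $s\to s'$ via $\mathtt{s}\mathtt{r}!a$ if $(q_\mathtt{s},\mathtt{s}\mathtt{r}!a,q'_\mathtt{s})\in\delta_\mathtt{s}$, other local states unchanged, $w'_{\mathtt{s}\mathtt{r}}=w_{\mathtt{s}\mathtt{r}}\cdot a$, other channels unchanged; via $\mathtt{s}\mathtt{r}?a$ if $(q_\mathtt{r},\mathtt{s}\mathtt{r}?a,q'_\mathtt{r})\in\delta_\mathtt{r}$, other local states unchanged, $w_{\mathtt{s}\mathtt{r}}=a\cdot w'_{\mathtt{s}\mathtt{r}}$, other channels unchanged. $RS(S)$ is the set of configurations reachable from the initial one. For $\varphi\in Act^*$, $\varphi^{\not C}$ erases channel names; the dual $\overline{\cdot}$ swaps $!a$ and $?a$. CFSMs $M,M'$ are compatible, $M\leftrightarrow M'$, if $\mathcal{L}(M)^{\not C}=\overline{\mathcal{L}(M')^{\not C}}$, neither has mixed states, and both are ?!-deterministic. Gateway: for a CFSM $M_{\tt H}=(Q,q_0,\mathbb{A},\delta)$ and a role ${\tt K}$, $\mathrm{gw}(M_{\tt H},{\tt K})=(Q\cup\widehat{Q},q_0,\mathbb{A},\delta')$ where $\widehat Q$ has one fresh state $q^{t}$ for each $t=(q,l,q')\in\delta$, and $\delta'$ consists of: for each $t=(q,{\tt H}\mathtt{s}!a,q')\in\delta$, transitions $(q,{\tt K}{\tt H}?a,q^{t})$, $(q^{t},{\tt H}\mathtt{s}!a,q')$; for each $t=(q,\mathtt{s}{\tt H}?a,q')\in\delta$,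 transitions $(q,\mathtt{s}{\tt H}?a,q^{t})$, $(q^{t},{\tt H}{\tt K}!a,q')$. Composition: for $S_1=(M^1_\mathtt{p})_{\mathtt{p}\in\mathbf{P}_1}$ over $\mathbf{P}_1,\mathbb{A}_1$ and $S_2=(M^2_\mathtt{p})_{\mathtt{p}\in\mathbf{P}_2}$ over $\mathbf{P}_2,\mathbb{A}_2$, $\mathbf{P}_1\cap\mathbf{P}_2=\emptyset$, ${\tt H}\in\mathbf{P}_1$, ${\tt K}\in\mathbf{P}_2$, $M^1_{\tt H}\leftrightarrow M^2_{\tt K}$: $S_1\bowtie_{{\tt H},{\tt K}}S_2=(M_\mathtt{p})_{\mathtt{p}\in\mathbf{P}_1\cup\mathbf{P}_2}$ over $\mathbf{P}_1\cup\mathbf{P}_2$, $\mathbb{A}_1\cup\mathbb{A}_2$, with $M_{\tt H}=\mathrm{gw}(M^1_{\tt H},{\tt K})$, $M_{\tt K}=\mathrm{gw}(M^2_{\tt K},{\tt H})$, $M_\mathtt{p}=M^i_\mathtt{p}$ for other $\mathtt{p}\in\mathbf{P}_i$. $Q_{\tt H}$ denotes the states of $M^1_{\tt H}$ and $\widehat{Q_{\tt H}}$ the fresh gateway states of $M_{\tt H}$; likewise for ${\tt K}$. -}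

module Defs where

open import Data.Nat using (ℕ)
open import Data.Fin using (Fin)
open import Data.List using (List; []; _∷_; _++_; map; concat; length; lookup; allFin)
open import Data.List.Membership.Propositional using (_∈_; _∉_)
open import Data.List.Membership.Propositional.Properties using (∈-++⁺ˡ; ∈-++⁺ʳ; ∈-map⁺; ∈-allFin)
open import Data.Product using (Σ; ∃; _×_; _,_; proj₁; proj₂)
open import Data.Sum using (_⊎_; inj₁; inj₂)
open import Data.Empty using (⊥)
open import Data.Unit using (⊤)
open import Relation.Nullary using (Dec; yes; no; ¬_)
open import Relation.Binary.Definitions using (DecidableEquality)
open import Relation.Binary.PropositionalEquality using (_≡_; _≢_; refl)
open import Relation.Binary.Construct.Closure.ReflexiveTransitive using (Star)

Finite : Set → Set
Finite A = Σ (List A) (λ xs → ∀ x → x ∈ xs)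

Finite-⊎-Fin : {A : Set} (n : ℕ) → Finite A → Finite (A ⊎ Fin n)
Finite-⊎-Fin {A} n (xs , all) = map inj₁ xs ++ map inj₂ (allFin n) , f
  where
  f : (x : A ⊎ Fin n) → x ∈ map inj₁ xs ++ map inj₂ (allFin n)
  f (inj₁ a) = ∈-++⁺ˡ (∈-map⁺ inj₁ (all a))
  f (inj₂ i) = ∈-++⁺ʳ (map inj₁ xs) (∈-map⁺ inj₂ (∈-allFin i))

-- Actions.  Roles range over a type R, messages over a type Msg.
-- The label (s , r , snd , a) is  s r ! a,  (s , r , rcv , a) is  s r ? a.

data Dir : Set where
  snd rcv : Dir

Act : Set → Set → Set
Act R Msg = R × R × Dir × Msg

renAct : {R R' Msg : Set} → (R → R') → Act R Msg → Act R' Msg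
renAct f (s , r , d , a) = f s , f r , d , a

actor : {R Msg : Set} → Act R Msg → R
actor (s , r , snd , a) = s
actor (s , r , rcv , a) = r

dirOf : {R Msg : Set} → Act R Msg → Dir
dirOf (s , r , d , a) = d

erase : {R Msg : Set} → Act R Msg → Dir × Msg
erase (s , r , d , a) = d , a

dualDir : Dir → Dir
dualDir snd = rcv
dualDir rcv = snd

dualE : {Msg : Set} → Dir × Msg → Dir × Msg
dualE (d , a) = dualDir d , a

record CFSM (R Msg : Set) : Set₁ where
  field
    Q    : Set
    q0   : Q
    δ    : List (Q × Act R Msg × Q)
    finQ : Finite Q

open CFSM public

-- language with all states accepting: φ ∈ L(M) iff φ labels a path from q0
data PathFrom {R Msg : Set} (M : CFSM R Msg) : Q M → List (Act R Msg) → Set where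
  []  : ∀ {q} → PathFrom M q []
  _∷_ : ∀ {q l q' φ} → (q , l , q') ∈ δ M → PathFrom M q' φ → PathFrom M q (l ∷ φ)

Lang : {R Msg : Set} → CFSM R Msg → List (Act R Msg) → Set
Lang M φ = PathFrom M (q0 M) φ

ErasedLang : {R Msg : Set} → CFSM R Msg → List (Dir × Msg) → Set
ErasedLang M w = ∃ λ φ → Lang M φ × map erase φ ≡ w

module _ {R Msg : Set} (M : CFSM R Msg) where

  Final : Q M → Set
  Final q = ∀ l q' → (q , l , q') ∉ δ M

  Sending : Q M → Set
  Sending q = ∀ l q' → (q , l , q') ∈ δ M → dirOf l ≡ snd

  Receiving : Q M → Set
  Receiving q = ∀ l q' → (q , l , q') ∈ δ M → dirOf l ≡ rcv

  NoMixed : Set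
  NoMixed = ∀ q → Sending q ⊎ Receiving q

  ?-Det : Set
  ?-Det = ∀ q r s p p' a q' q'' →
    (q , (r , s , rcv , a) , q') ∈ δ M → (q , (p , p' , rcv , a) , q'') ∈ δ M → q' ≡ q''

  !-Det : Set
  !-Det = ∀ q r s p p' a q' q'' →
    (q , (r , s , snd , a) , q') ∈ δ M → (q , (p , p' , snd , a) , q'') ∈ δ M → q' ≡ q''

  ?!-Det : Set
  ?!-Det = ?-Det × !-Det

Compatible : {R R' Msg : Set} → CFSM R Msg → CFSM R' Msg → Set
Compatible M M' =
  (∀ w → ErasedLang M w → ErasedLang M' (map dualE w)) ×
  (∀ w → ErasedLang M' (map dualE w) → ErasedLang M w) ×
  NoMixed M × NoMixed M' × ?!-Det M × ?!-Det M'

System : Set → Set → Set₁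
System R Msg = R → CFSM R Msg

WfMachine : {R Msg : Set} → R → CFSM R Msg → Set
WfMachine p M = ∀ q l q' → (q , l , q') ∈ δ M →
  actor l ≡ p × proj₁ l ≢ proj₁ (proj₂ l)

WfSystem : {R Msg : Set} → System R Msg → Set
WfSystem S = ∀ p → WfMachine p (S p)

record Config {R Msg : Set} (S : System R Msg) : Set where
  constructor cfg
  field
    st : (p : R) → Q (S p)
    ch : R → R → List Msg

open Config public

initial : {R Msg : Set} (S : System R Msg) → Config S
initial S = cfg (λ p → q0 (S p)) (λ _ _ → [])

data Step {R Msg : Set} (S : System R Msg) (c c' : Config S) : Set where
  send : ∀ s r a →
    (st c s , (s , r , snd , a) , st c' s) ∈ δ (S s) →
    (∀ p → p ≢ s → st c' p ≡ st c p) →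
    ch c' s r ≡ ch c s r ++ (a ∷ []) →
    (∀ p p' → (p , p') ≢ (s , r) → ch c' p p' ≡ ch c p p') →
    Step S c c'
  recv : ∀ s r a →
    (st c r , (s , r , rcv , a) , st c' r) ∈ δ (S r) →
    (∀ p → p ≢ r → st c' p ≡ st c p) →
    ch c s r ≡ a ∷ ch c' s r →
    (∀ p p' → (p , p') ≢ (s , r) → ch c' p p' ≡ ch c p p') →
    Step S c c'

Reachable : {R Msg : Set} (S : System R Msg) → Config S → Set
Reachable S c = Star (Step S) (initial S) c

-- relabel roles (embedding of P_i into P_1 ∪ P_2)
rename : {R R' Msg : Set} → (R → R') → CFSM R Msg → CFSM R' Msg
rename f M = record
  { Q = Q M ; q0 = q0 M
  ; δ = map (λ { (q , l , q') → q , renAct f l , q' }) (δ M)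
  ; finQ = finQ M }

gwT : {R Msg S : Set} {n : ℕ} → R → R → Fin n → S × Act R Msg × S →
      List ((S ⊎ Fin n) × Act R Msg × (S ⊎ Fin n))
gwT H K i (q , (p , s , snd , a) , q') =
  (inj₁ q , (K , H , rcv , a) , inj₂ i) ∷ (inj₂ i , (H , s , snd , a) , inj₁ q') ∷ []
gwT H K i (q , (s , p , rcv , a) , q') =
  (inj₁ q , (s , H , rcv , a) , inj₂ i) ∷ (inj₂ i , (H , K , snd , a) , inj₁ q') ∷ []

-- gw(M_H, K); the fresh state q^t for the i-th transition t is inj₂ i
gw : {R Msg : Set} → CFSM R Msg → R → R → CFSM R Msg
gw M H K = record
  { Q = Q M ⊎ Fin (length (δ M))
  ; q0 = inj₁ (q0 M)
  ; δ = concat (map (λ i → gwT H K i (lookup (δ M) i)) (allFin (length (δ M))))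
  ; finQ = Finite-⊎-Fin (length (δ M)) (finQ M) }

IsFresh : {R Msg : Set} (M : CFSM R Msg) (H K : R) → Q (gw M H K) → Set
IsFresh M H K (inj₁ _) = ⊥
IsFresh M H K (inj₂ _) = ⊤

module Composition {R₁ R₂ Msg : Set}
  (_≟₁_ : DecidableEquality R₁) (_≟₂_ : DecidableEquality R₂)
  (S₁ : System R₁ Msg) (S₂ : System R₂ Msg) (H : R₁) (K : R₂) where

  MH : CFSM (R₁ ⊎ R₂) Msg
  MH = gw (rename inj₁ (S₁ H)) (inj₁ H) (inj₂ K)

  MK : CFSM (R₁ ⊎ R₂) Msg
  MK = gw (rename inj₂ (S₂ K)) (inj₂ K) (inj₁ H)

  side₁ : (p : R₁) → Dec (H ≡ p) → CFSM (R₁ ⊎ R₂) Msg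
  side₁ p (yes _) = MH
  side₁ p (no _)  = rename inj₁ (S₁ p)

  side₂ : (p : R₂) → Dec (K ≡ p) → CFSM (R₁ ⊎ R₂) Msg
  side₂ p (yes _) = MK
  side₂ p (no _)  = rename inj₂ (S₂ p)

  compose : System (R₁ ⊎ R₂) Msg
  compose (inj₁ p) = side₁ p (H ≟₁ p)
  compose (inj₂ p) = side₂ p (K ≟₂ p)

  fresh₁ : (p : R₁) (d : Dec (H ≡ p)) → Q (side₁ p d) → Set
  fresh₁ p (yes _) q = IsFresh (rename inj₁ (S₁ H)) (inj₁ H) (inj₂ K) q
  fresh₁ p (no _)  q = ⊥

  fresh₂ : (p : R₂) (d : Dec (K ≡ p)) → Q (side₂ p d) → Set
  fresh₂ p (yes _) q = IsFresh (rename inj₂ (S₂ K)) (inj₂ K) (inj₁ H) q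
  fresh₂ p (no _)  q = ⊥

  FreshH : Q (compose (inj₁ H)) → Set
  FreshH = fresh₁ H (H ≟₁ H)

  FreshK : Q (compose (inj₂ K)) → Set
  FreshK = fresh₂ K (K ≟₂ K)

module Submission where

-- Let A = M¹_H, B = M²_K.  Abstract each configuration to its
-- "link": the state of A that gateway H is committed to, the queue qA of
-- messages A has received (pending in H or on channel HK) that B has yet to
-- send, and symmetrically B's state and qB.  Every system step is an abstract
-- Move on the link: A sends m (taking m from the head of qB), A receives m
-- (appending m to qA), or nothing; likewise for B.  The invariant Sync says one
-- queue is empty and, up to the sends in the other queue, A and B followed dual
-- traces.  It is preserved because a machine that is behind cannot receive:
-- by compatibility and determinism its state can send, so it is not receiving.
-- In the theorem's configuration both queues are empty, so A and B followed
-- exactly dual traces and have dual modes; unfolding the gateway construction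
-- yields (a) or (b).

open import Defs
open import Function using (_∘_)
open import Data.Empty using (⊥; ⊥-elim)
open import Data.List using (List; []; _∷_; _++_; map; length; lookup; allFin; reverse; _ʳ++_)
open import Data.List.Membership.Propositional using (_∈_)
open import Data.List.Membership.Propositional.Properties using (∈-map⁻; ∈-concat⁻′; ∈-lookup)
open import Data.List.Properties using (++-ʳ++; ++-identityʳ; map-++; map-∘; map-id; map-cong; reverse-map; reverse-involutive)
open import Data.List.Relation.Unary.Any using (here; there)
open import Data.Product using (∃; ∃₂; _×_; _,_; proj₁; proj₂)
open import Data.Sum as Sum using (_⊎_; inj₁; inj₂; swap; [_,_])
open import Data.Sum.Properties using (inj₁-injective; inj₂-injective)
open import Data.Unit using (tt)
open import Relation.Binary.Construct.Closure.ReflexiveTransitive using (Star; ε; _◅_)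
open import Relation.Binary.Definitions using (DecidableEquality)
open import Relation.Binary.PropositionalEquality using (_≡_; _≢_; refl; sym; trans; cong; subst)
open import Relation.Nullary using (Dec; yes; no; ¬_)

E : Set → Set
E Msg = Dir × Msg

snd≢rcv : snd ≢ rcv
snd≢rcv ()

dualDir-flip : ∀ {x d} → dualDir x ≡ d → x ≡ dualDir d
dualDir-flip {snd} refl = refl
dualDir-flip {rcv} refl = refl

dualE-involutive : {Msg : Set} (e : E Msg) → dualE (dualE e) ≡ e
dualE-involutive (snd , m) = refl
dualE-involutive (rcv , m) = refl

dual-involutive : {Msg : Set} (w : List (E Msg)) → map dualE (map dualE w) ≡ w
dual-involutive w = trans (sym (map-∘ w)) (trans (map-cong dualE-involutive w) (map-id w))

reverse-dual : {Msg : Set} (w : List (E Msg)) → reverse (map dualE (reverse w)) ≡ map dualE w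
reverse-dual w = trans (cong reverse (reverse-map dualE w)) (reverse-involutive (map dualE w))

data ETrans {R Msg : Set} (M : CFSM R Msg) (q : Q M) (e : E Msg) (q' : Q M) : Set where
  edge : ∀ {l} → (q , l , q') ∈ δ M → erase l ≡ e → ETrans M q e q'

-- Run M rw q: M performs the erased trace rw from its initial state and ends
-- in q; traces are stored newest action first
data Run {R Msg : Set} (M : CFSM R Msg) : List (E Msg) → Q M → Set where
  start : Run M [] (q0 M)
  _▷_   : ∀ {rw q e q'} → Run M rw q → ETrans M q e q' → Run M (e ∷ rw) q'

module _ {R Msg : Set} {M : CFSM R Msg} where

  etrans-det : ?!-Det M → ∀ {q e q₁ q₂} → ETrans M q e q₁ → ETrans M q e q₂ → q₁ ≡ q₂
  etrans-det (det? , _) (edge {r , s , rcv , m} t₁ refl) (edge {r' , s' , _ , _} t₂ refl) =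
    det? _ r s r' s' m _ _ t₁ t₂
  etrans-det (_ , det!) (edge {r , s , snd , m} t₁ refl) (edge {r' , s' , _ , _} t₂ refl) =
    det! _ r s r' s' m _ _ t₁ t₂

  run-det : ?!-Det M → ∀ {rw q₁ q₂} → Run M rw q₁ → Run M rw q₂ → q₁ ≡ q₂
  run-det det start start = refl
  run-det det (r₁ ▷ t₁) (r₂ ▷ t₂) with run-det det r₁ r₂
  ... | refl = etrans-det det t₁ t₂

  run-prefix : ∀ xs {rw q} → Run M (xs ʳ++ rw) q → ∃ λ q' → Run M rw q'
  run-prefix []       r = _ , r
  run-prefix (x ∷ xs) r with run-prefix xs r
  ... | _ , (r' ▷ _) = _ , r'

  run-path→lang : ∀ {rw q φ} → Run M rw q → PathFrom M q φ → ErasedLang M (rw ʳ++ map erase φ)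
  run-path→lang start             p = _ , p , refl
  run-path→lang (r ▷ edge t refl) p = run-path→lang r (t ∷ p)

  run→lang : ∀ {rw q} → Run M rw q → ErasedLang M (reverse rw)
  run→lang r = run-path→lang r []

  path→run : ∀ {rw q φ} → Run M rw q → PathFrom M q φ → ∃ λ q' → Run M (map erase φ ʳ++ rw) q'
  path→run r []      = _ , r
  path→run r (t ∷ p) = path→run (r ▷ edge t refl) p

  lang→run : ∀ {w} → ErasedLang M w → ∃ λ q → Run M (reverse w) q
  lang→run (_ , p , refl) = path→run start p

Mirrors : {R R' Msg : Set} → CFSM R Msg → CFSM R' Msg → Set
Mirrors A B = ∀ {rw q} → Run A rw q → ∃ λ q' → Run B (map dualE rw) q'

mirrors : {R R' Msg : Set} {A : CFSM R Msg} {B : CFSM R' Msg} →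
  (∀ w → ErasedLang A w → ErasedLang B (map dualE w)) → Mirrors A B
mirrors {B = B} incl {rw} r with lang→run (incl _ (run→lang r))
... | q' , r' = q' , subst (λ w → Run B w q') (reverse-dual rw) r'

compatible-mirrors : {R R' Msg : Set} {A : CFSM R Msg} {B : CFSM R' Msg} →
  Compatible A B → Mirrors A B × Mirrors B A
compatible-mirrors {A = A} {B} (A⊆B , B⊆A , _) = mirrors A⊆B , mirrors B⊆A'
  where
  B⊆A' : ∀ w → ErasedLang B w → ErasedLang A (map dualE w)
  B⊆A' w e = B⊆A (map dualE w) (subst (ErasedLang B) (sym (dual-involutive w)) e)

Moded : {R Msg : Set} (M : CFSM R Msg) → Dir → Q M → Set
Moded M d q = ∀ l q' → (q , l , q') ∈ δ M → dirOf l ≡ d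

module _ {R Msg : Set} {M : CFSM R Msg} where

  mode-of : ∀ {d q e q'} → Moded M d q → ETrans M q e q' → proj₁ e ≡ d
  mode-of mode (edge {l} t refl) = mode l _ t

  not-mixed : NoMixed M → ∀ {q m m' q₁ q₂} → ETrans M q (snd , m) q₁ → ETrans M q (rcv , m') q₂ → ⊥
  not-mixed nm {q} s r =
    [ (λ sending → snd≢rcv (sym (mode-of sending r))) , (λ receiving → snd≢rcv (mode-of receiving s)) ] (nm q)

dual-mode : {R R' Msg : Set} {A : CFSM R Msg} {B : CFSM R' Msg} →
  ?!-Det A → Mirrors B A → ∀ {rw pa pb d} → Run A rw pa → Run B (map dualE rw) pb →
  Moded A d pa → Moded B (dualDir d) pb
dual-mode {A = A} det mir {rw} rA rB mode l _ t with mir (rB ▷ edge t refl)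
... | q , r with subst (λ w → Run A (dualE (erase l) ∷ w) q) (dual-involutive rw) r
... | rA' ▷ t' with run-det det rA' rA
... | refl = dualDir-flip (mode-of mode t')

withSends : {Msg : Set} → List (E Msg) → List Msg → List (E Msg)
withSends rw ms = map (snd ,_) ms ʳ++ rw

withSends-snoc : {Msg : Set} (rw : List (E Msg)) (ms : List Msg) (m : Msg) →
  withSends rw (ms ++ m ∷ []) ≡ (snd , m) ∷ withSends rw ms
withSends-snoc rw ms m = trans (cong (_ʳ++ rw) (map-++ (snd ,_) ms (m ∷ []))) (++-ʳ++ (map (snd ,_) ms))

-- One move of machine A on the link, from (q, qA, qB) to (q', qA', qB').
-- qA holds the messages A received that its partner has yet to send, qB the
-- messages the partner received that A has yet to send.
data Move {R Msg : Set} (A : CFSM R Msg) : Q A → List Msg → List Msg → Q A → List Msg → List Msg → Set where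
  idle : ∀ {q qA qB} → Move A q qA qB q qA qB
  send : ∀ {q m q' qA qB} → ETrans A q (snd , m) q' → Move A q qA (m ∷ qB) q' qA qB
  recv : ∀ {q m q' qA qB} → ETrans A q (rcv , m) q' → Move A q qA qB q' (qA ++ m ∷ []) qB

Lag : {R R' Msg : Set} (A : CFSM R Msg) (B : CFSM R' Msg) → Q A → Q B → List Msg → Set
Lag A B pa pb qB = ∃ λ rw → Run A rw pa × Run B (map dualE (withSends rw qB)) pb

Sync : {R R' Msg : Set} (A : CFSM R Msg) (B : CFSM R' Msg) → Q A → List Msg → Q B → List Msg → Set
Sync A B pa qA pb qB = (Lag A B pa pb qB × qA ≡ []) ⊎ (Lag B A pb pa qA × qB ≡ [])

module _ {R R' Msg : Set} {A : CFSM R Msg} {B : CFSM R' Msg}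
  (nm : NoMixed A) (det : ?!-Det A) (mir : Mirrors B A) where

  -- a machine that is behind by at least one send cannot receive: its state
  -- is the one reached before the pending sends, so it is a sending state
  lag-blocks-recv : ∀ {pa pb m ms m' q'} → Lag A B pa pb (m ∷ ms) → ETrans A pa (rcv , m') q' → ⊥
  lag-blocks-recv {m = m} {ms} (rw , rA , rB) r with mir rB
  ... | q , rA⁺ with run-prefix (map (snd ,_) ms) {(snd , m) ∷ rw}
                       (subst (λ w → Run A w q) (dual-involutive (withSends rw (m ∷ ms))) rA⁺)
  ... | _ , (rA' ▷ s) with run-det det rA' rA
  ... | refl = not-mixed nm s r

  sync-move : ∀ {pa qA pb qB pa' qA' qB'} →
    Sync A B pa qA pb qB → Move A pa qA qB pa' qA' qB' → Sync A B pa' qA' pb qB'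
  sync-move s idle = s
  sync-move (inj₁ ((rw , rA , rB) , refl)) (send t) = inj₁ ((_ ∷ rw , rA ▷ t , rB) , refl)
  sync-move (inj₂ (_ , ())) (send t)
  sync-move (inj₁ ((rw , rA , rB) , refl)) (recv {qB = []} t) =
    inj₂ ((map dualE rw , rB , subst (λ w → Run A (_ ∷ w) _) (sym (dual-involutive rw)) (rA ▷ t)) , refl)
  sync-move (inj₁ (lag , refl)) (recv {qB = m ∷ ms} t) = ⊥-elim (lag-blocks-recv {m = m} {ms} lag t)
  sync-move (inj₂ ((rw , rB , rA) , refl)) (recv {m = m} {qA = qA} t) =
    inj₂ ((rw , rB , subst (λ w → Run A w _) (sym (cong (map dualE) (withSends-snoc rw qA m))) (rA ▷ t)) , refl)

  -- with both queues empty the machines followed exactly dual traces, so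
  -- their modes are dual
  rest-modes : ∀ {pa pb} → Sync A B pa [] pb [] →
    (Sending A pa × Receiving B pb) ⊎ (Receiving A pa × Sending B pb)
  rest-modes {pa} {pb} s with at-rest s
    where
    at-rest : Sync A B pa [] pb [] → ∃ λ rw → Run A rw pa × Run B (map dualE rw) pb
    at-rest (inj₁ ((rw , rA , rB) , _)) = rw , rA , rB
    at-rest (inj₂ ((rw , rB , rA) , _)) =
      map dualE rw , rA , subst (λ w → Run B w pb) (sym (dual-involutive rw)) rB
  ... | _ , rA , rB =
    Sum.map (λ sending → sending , dual-mode det mir rA rB sending)
            (λ receiving → receiving , dual-mode det mir rA rB receiving) (nm pa)

Avoids : {R Msg : Set} → CFSM R Msg → R → Set
Avoids M k = ∀ {q p s d m q'} → (q , (p , s , d , m) , q') ∈ δ M → p ≢ k × s ≢ k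

-- The effect of a move of role x with label l on the two channels between x
-- and y: inb (from y to x) becomes inb', out (from x to y) becomes out'.
record LinkEffect {R Msg : Set} (x y : R) (l : Act R Msg) (inb out inb' out' : List Msg) : Set where
  field
    consumed : ∀ m → l ≡ (y , x , rcv , m) → inb ≡ m ∷ inb'
    inbKept  : (∀ m → l ≢ (y , x , rcv , m)) → inb' ≡ inb
    produced : ∀ m → l ≡ (x , y , snd , m) → out' ≡ out ++ m ∷ []
    outKept  : (∀ m → l ≢ (x , y , snd , m)) → out' ≡ out

open LinkEffect

module Gateway {R Msg : Set} (M : CFSM R Msg) (a k : R) where

  data GwT : Q (gw M a k) → Act R Msg → Q (gw M a k) → Set where
    send-get : ∀ i {q p s m q'} → lookup (δ M) i ≡ (q , (p , s , snd , m) , q') →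
      GwT (inj₁ q) (k , a , rcv , m) (inj₂ i)
    send-put : ∀ i {q p s m q'} → lookup (δ M) i ≡ (q , (p , s , snd , m) , q') →
      GwT (inj₂ i) (a , s , snd , m) (inj₁ q')
    recv-get : ∀ i {q s p m q'} → lookup (δ M) i ≡ (q , (s , p , rcv , m) , q') →
      GwT (inj₁ q) (s , a , rcv , m) (inj₂ i)
    recv-put : ∀ i {q s p m q'} → lookup (δ M) i ≡ (q , (s , p , rcv , m) , q') →
      GwT (inj₂ i) (a , k , snd , m) (inj₁ q')

  gwT-inv : ∀ {u l v} i t → lookup (δ M) i ≡ t → (u , l , v) ∈ gwT a k i t → GwT u l v
  gwT-inv i (_ , (_ , _ , snd , _) , _) eq (here refl)         = send-get i eq
  gwT-inv i (_ , (_ , _ , snd , _) , _) eq (there (here refl)) = send-put i eq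
  gwT-inv i (_ , (_ , _ , rcv , _) , _) eq (here refl)         = recv-get i eq
  gwT-inv i (_ , (_ , _ , rcv , _) , _) eq (there (here refl)) = recv-put i eq

  gw-inv : ∀ {u l v} → (u , l , v) ∈ δ (gw M a k) → GwT u l v
  gw-inv t with ∈-concat⁻′ (map (λ i → gwT a k i (lookup (δ M) i)) (allFin (length (δ M)))) t
  ... | _ , t₁ , t₂ with ∈-map⁻ (λ i → gwT a k i (lookup (δ M) i)) t₂
  ... | i , _ , refl = gwT-inv i _ refl t₁

  listed : ∀ {i t} → lookup (δ M) i ≡ t → t ∈ δ M
  listed {i} eq = subst (_∈ δ M) eq (∈-lookup i)

  -- the state of M a gateway state has committed to
  base : Q (gw M a k) → Q M
  base (inj₁ q) = q
  base (inj₂ i) = proj₂ (proj₂ (lookup (δ M) i))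

  received : Q M × Act R Msg × Q M → List Msg
  received (_ , (_ , _ , snd , _) , _) = []
  received (_ , (_ , _ , rcv , m) , _) = m ∷ []

  -- the message a gateway state has received but not yet forwarded to k
  pending : Q (gw M a k) → List Msg
  pending (inj₁ _) = []
  pending (inj₂ i) = received (lookup (δ M) i)

  -- every gateway transition is an abstract move of M on the link, where the
  -- queue of M is its outgoing channel followed by its pending message and the
  -- queue of the partner is M's incoming channel followed by whatever rest
  gateway-move : Avoids M k → ∀ {u l v inb out inb' out' rest} →
    GwT u l v → LinkEffect a k l inb out inb' out' →
    Move M (base u) (out ++ pending u) (inb ++ rest) (base v) (out' ++ pending v) (inb' ++ rest)
  gateway-move av (send-get i eq) eff with consumed eff _ refl | outKept eff (λ _ ())
  ... | refl | refl rewrite eq = send (edge (listed eq) refl)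
  gateway-move av (send-put i eq) eff
    with inbKept eff (λ _ ()) | outKept eff (λ _ e → proj₂ (av (listed eq)) (cong (proj₁ ∘ proj₂) e))
  ... | refl | refl rewrite eq = idle
  gateway-move av {out = out} (recv-get i eq) eff
    with inbKept eff (λ _ e → proj₁ (av (listed eq)) (cong proj₁ e)) | outKept eff (λ _ ())
  ... | refl | refl rewrite eq | ++-identityʳ out = recv (edge (listed eq) refl)
  gateway-move av {out = out} (recv-put i {m = m} eq) eff with inbKept eff (λ _ ()) | produced eff _ refl
  ... | refl | refl rewrite eq | ++-identityʳ (out ++ m ∷ []) = idle

  gw-sending : ∀ {q} → Sending M q →
    ∀ l v → (inj₁ q , l , v) ∈ δ (gw M a k) → ∃ λ m → l ≡ (k , a , rcv , m)
  gw-sending sending l v t with gw-inv t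
  ... | send-get i eq = _ , refl
  ... | recv-get i eq with sending _ _ (listed eq)
  ...   | ()

  gw-receiving : Avoids M k → ∀ {q} → Receiving M q →
    ∀ l v → (inj₁ q , l , v) ∈ δ (gw M a k) → ∃₂ λ s m → l ≡ (s , a , rcv , m) × s ≢ k
  gw-receiving av receiving l v t with gw-inv t
  ... | recv-get i eq = _ , _ , refl , proj₁ (av (listed eq))
  ... | send-get i eq with receiving _ _ (listed eq)
  ...   | ()

module _ {R R' Msg : Set} (f : R → R') {M : CFSM R Msg} where

  rename-inv : ∀ {q l q'} → (q , l , q') ∈ δ (rename f M) →
    ∃ λ l₀ → (q , l₀ , q') ∈ δ M × l ≡ renAct f l₀
  rename-inv t with ∈-map⁻ _ t
  ... | (_ , l₀ , _) , t₀ , refl = l₀ , t₀ , refl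

  -- erased behaviour does not see role names
  move-unrename : ∀ {q qA qB q' qA' qB'} → Move (rename f M) q qA qB q' qA' qB' → Move M q qA qB q' qA' qB'
  move-unrename idle = idle
  move-unrename (send (edge t e)) with rename-inv t
  ... | _ , t₀ , refl = send (edge t₀ e)
  move-unrename (recv (edge t e)) with rename-inv t
  ... | _ , t₀ , refl = recv (edge t₀ e)

  moded-rename : ∀ {d q} → Moded M d q → Moded (rename f M) d q
  moded-rename mode l q' t with rename-inv t
  ... | l₀ , t₀ , refl = mode l₀ q' t₀

  avoids-rename : ∀ {k} → (∀ x → f x ≢ k) → Avoids (rename f M) k
  avoids-rename f≢k t with rename-inv t
  ... | (p , s , _ , _) , _ , refl = f≢k p , f≢k s

record Turn {R Msg : Set} (S : System R Msg) (c c' : Config S) (x : R) : Set where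
  field
    label   : Act R Msg
    moves   : (st c x , label , st c' x) ∈ δ (S x)
    others  : ∀ p → p ≢ x → st c' p ≡ st c p
    linked  : ∀ y → y ≢ x → LinkEffect x y label (ch c y x) (ch c x y) (ch c' y x) (ch c' x y)
    distant : ∀ u v → u ≢ x → v ≢ x → ch c' u v ≡ ch c u v

open Turn

turn-of : {R Msg : Set} {S : System R Msg} {c c' : Config S} → Step S c c' → ∃ λ x → Turn S c c' x
turn-of {c = c} {c'} (send s r m t fr chS chO) = s , record
  { label = _ ; moves = t ; others = fr ; linked = effect ; distant = λ u v u≢s _ → chO u v (u≢s ∘ cong proj₁) }
  where
  effect : ∀ y → y ≢ s → LinkEffect s y (s , r , snd , m) (ch c y s) (ch c s y) (ch c' y s) (ch c' s y)
  effect y y≢s = record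
    { consumed = λ _ ()
    ; inbKept  = λ _ → chO y s (y≢s ∘ cong proj₁)
    ; produced = λ { _ refl → chS }
    ; outKept  = λ ne → chO s y (λ { refl → ne m refl }) }
turn-of {c = c} {c'} (recv s r m t fr chS chO) = r , record
  { label = _ ; moves = t ; others = fr ; linked = effect ; distant = λ u v _ v≢r → chO u v (v≢r ∘ cong proj₂) }
  where
  effect : ∀ y → y ≢ r → LinkEffect r y (s , r , rcv , m) (ch c y r) (ch c r y) (ch c' y r) (ch c' r y)
  effect y y≢r = record
    { consumed = λ { _ refl → chS }
    ; inbKept  = λ ne → chO y r (λ { refl → ne m refl })
    ; produced = λ _ ()
    ; outKept  = λ _ → chO r y (y≢r ∘ cong proj₂) }

module Composed {R₁ R₂ Msg : Set}
  (_≟₁_ : DecidableEquality R₁) (_≟₂_ : DecidableEquality R₂)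
  (S₁ : System R₁ Msg) (S₂ : System R₂ Msg) (H : R₁) (K : R₂)
  (compat : Compatible (S₁ H) (S₂ K)) where

  open Composition _≟₁_ _≟₂_ S₁ S₂ H K

  a k : R₁ ⊎ R₂
  a = inj₁ H
  k = inj₂ K

  module GH = Gateway (rename inj₁ (S₁ H)) a k
  module GK = Gateway (rename inj₂ (S₂ K)) k a

  nmA : NoMixed (S₁ H)
  nmA = proj₁ (proj₂ (proj₂ compat))

  nmB : NoMixed (S₂ K)
  nmB = proj₁ (proj₂ (proj₂ (proj₂ compat)))

  detA : ?!-Det (S₁ H)
  detA = proj₁ (proj₂ (proj₂ (proj₂ (proj₂ compat))))

  detB : ?!-Det (S₂ K)
  detB = proj₂ (proj₂ (proj₂ (proj₂ (proj₂ compat))))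

  mirAB : Mirrors (S₁ H) (S₂ K)
  mirAB = proj₁ (compatible-mirrors compat)

  mirBA : Mirrors (S₂ K) (S₁ H)
  mirBA = proj₂ (compatible-mirrors compat)

  avoidsA : Avoids (rename inj₁ (S₁ H)) k
  avoidsA = avoids-rename inj₁ {S₁ H} (λ _ ())

  avoidsB : Avoids (rename inj₂ (S₂ K)) a
  avoidsB = avoids-rename inj₂ {S₂ K} (λ _ ())

  -- The machine of role H in the composed system is MH, but only up to the
  -- decision H ≟₁ H; toH makes the identification explicit.
  toH : (d : Dec (H ≡ H)) → Q (side₁ H d) → Q MH
  toH (yes _)   q = q
  toH (no H≢H) _ = ⊥-elim (H≢H refl)

  toH-δ : ∀ d {u l v} → (u , l , v) ∈ δ (side₁ H d) → (toH d u , l , toH d v) ∈ δ MH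
  toH-δ (yes _)   t = t
  toH-δ (no H≢H) _ = ⊥-elim (H≢H refl)

  toH-q0 : ∀ d → toH d (q0 (side₁ H d)) ≡ inj₁ (q0 (S₁ H))
  toH-q0 (yes _)   = refl
  toH-q0 (no H≢H) = ⊥-elim (H≢H refl)

  toH-settled : ∀ d {q} → ¬ fresh₁ H d q → ∃ λ qa → toH d q ≡ inj₁ qa
  toH-settled (yes _) {inj₁ qa} _      = qa , refl
  toH-settled (yes _) {inj₂ _}  ¬fresh = ⊥-elim (¬fresh tt)
  toH-settled (no H≢H) _                = ⊥-elim (H≢H refl)

  toK : (d : Dec (K ≡ K)) → Q (side₂ K d) → Q MK
  toK (yes _)   q = q
  toK (no K≢K) _ = ⊥-elim (K≢K refl)

  toK-δ : ∀ d {u l v} → (u , l , v) ∈ δ (side₂ K d) → (toK d u , l , toK d v) ∈ δ MK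
  toK-δ (yes _)   t = t
  toK-δ (no K≢K) _ = ⊥-elim (K≢K refl)

  toK-q0 : ∀ d → toK d (q0 (side₂ K d)) ≡ inj₁ (q0 (S₂ K))
  toK-q0 (yes _)   = refl
  toK-q0 (no K≢K) = ⊥-elim (K≢K refl)

  toK-settled : ∀ d {q} → ¬ fresh₂ K d q → ∃ λ qb → toK d q ≡ inj₁ qb
  toK-settled (yes _) {inj₁ qb} _      = qb , refl
  toK-settled (yes _) {inj₂ _}  ¬fresh = ⊥-elim (¬fresh tt)
  toK-settled (no K≢K) _                = ⊥-elim (K≢K refl)

  hs : Config compose → Q MH
  hs c = toH (H ≟₁ H) (st c (inj₁ H))

  ks : Config compose → Q MK
  ks c = toK (K ≟₂ K) (st c (inj₂ K))

  -- the link invariant for gateway states hs, ks and channels kh (K to H), hk (H to K)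
  SyncAt : Q MH → Q MK → List Msg → List Msg → Set
  SyncAt hs ks kh hk = Sync (S₁ H) (S₂ K) (GH.base hs) (hk ++ GH.pending hs) (GK.base ks) (kh ++ GK.pending ks)

  SyncAt-cong : ∀ {hs hs' ks ks' kh kh' hk hk'} → hs ≡ hs' → ks ≡ ks' → kh ≡ kh' → hk ≡ hk' →
    SyncAt hs ks kh hk → SyncAt hs' ks' kh' hk'
  SyncAt-cong refl refl refl refl s = s

  SyncC : Config compose → Set
  SyncC c = SyncAt (hs c) (ks c) (ch c k a) (ch c a k)

  sync-initial : SyncC (initial compose)
  sync-initial = SyncAt-cong {kh = []} {hk = []} (sym (toH-q0 (H ≟₁ H))) (sym (toK-q0 (K ≟₂ K))) refl refl
    (inj₁ (([] , start , start) , refl))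

  -- a move of gateway H is a move of M¹_H on the link
  H-move : ∀ {c c' l} → SyncC c → (hs c , l , hs c') ∈ δ MH → ks c' ≡ ks c →
    LinkEffect a k l (ch c k a) (ch c a k) (ch c' k a) (ch c' a k) → SyncC c'
  H-move {c} {c'} sync t ks≡ eff = SyncAt-cong {hs = hs c'} {kh = ch c' k a} {hk = ch c' a k} refl (sym ks≡) refl refl
    (sync-move nmA detA mirBA sync (move-unrename inj₁ (GH.gateway-move avoidsA (GH.gw-inv t) eff)))

  -- a move of gateway K is a move of M²_K on the link, seen from the other side
  K-move : ∀ {c c' l} → SyncC c → (ks c , l , ks c') ∈ δ MK → hs c' ≡ hs c →
    LinkEffect k a l (ch c a k) (ch c k a) (ch c' a k) (ch c' k a) → SyncC c'
  K-move {c} {c'} sync t hs≡ eff = SyncAt-cong {ks = ks c'} {kh = ch c' k a} {hk = ch c' a k} (sym hs≡) refl refl refl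
    (swap (sync-move nmB detB mirAB (swap sync) (move-unrename inj₂ (GK.gateway-move avoidsB (GK.gw-inv t) eff))))

  quiet : ∀ {c c'} → hs c' ≡ hs c → ks c' ≡ ks c → ch c' k a ≡ ch c k a → ch c' a k ≡ ch c a k →
    SyncC c → SyncC c'
  quiet hs≡ ks≡ kh≡ hk≡ = SyncAt-cong (sym hs≡) (sym ks≡) (sym kh≡) (sym hk≡)

  turn₁ : ∀ {c c'} p → Dec (H ≡ p) → Turn compose c c' (inj₁ p) → SyncC c → SyncC c'
  turn₁ {c} {c'} p (yes refl) τ s =
    H-move {c} {c'} s (toH-δ (H ≟₁ H) (moves τ)) (cong (toK (K ≟₂ K)) (others τ k (λ ()))) (linked τ k (λ ()))
  turn₁ {c} {c'} p (no H≢p)   τ =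
    quiet {c} {c'} (cong (toH (H ≟₁ H)) (others τ a a≢p)) (cong (toK (K ≟₂ K)) (others τ k (λ ())))
          (distant τ k a (λ ()) a≢p) (distant τ a k a≢p (λ ()))
    where
    a≢p : a ≢ inj₁ p
    a≢p = H≢p ∘ inj₁-injective

  turn₂ : ∀ {c c'} p → Dec (K ≡ p) → Turn compose c c' (inj₂ p) → SyncC c → SyncC c'
  turn₂ {c} {c'} p (yes refl) τ s =
    K-move {c} {c'} s (toK-δ (K ≟₂ K) (moves τ)) (cong (toH (H ≟₁ H)) (others τ a (λ ()))) (linked τ a (λ ()))
  turn₂ {c} {c'} p (no K≢p)   τ =
    quiet {c} {c'} (cong (toH (H ≟₁ H)) (others τ a (λ ()))) (cong (toK (K ≟₂ K)) (others τ k k≢p))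
          (distant τ k a k≢p (λ ())) (distant τ a k (λ ()) k≢p)
    where
    k≢p : k ≢ inj₂ p
    k≢p = K≢p ∘ inj₂-injective

  sync-step : ∀ {c c'} → Step compose c c' → SyncC c → SyncC c'
  sync-step step with turn-of step
  ... | inj₁ p , τ = turn₁ p (H ≟₁ p) τ
  ... | inj₂ p , τ = turn₂ p (K ≟₂ p) τ

  sync-along : ∀ {c c'} → Star (Step compose) c c' → SyncC c → SyncC c'
  sync-along ε            s = s
  sync-along (step ◅ run) s = sync-along run (sync-step step s)

  sync-reachable : ∀ {c} → Reachable compose c → SyncC c
  sync-reachable run = sync-along run sync-initial

  settled-H : ∀ {q qa} → toH (H ≟₁ H) q ≡ inj₁ qa → {P : Act (R₁ ⊎ R₂) Msg → Set} →
    (∀ l v → (inj₁ qa , l , v) ∈ δ MH → P l) → ∀ l v → (q , l , v) ∈ δ (compose (inj₁ H)) → P l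
  settled-H eq P-gw l v t = P-gw l _ (subst (λ u → (u , l , _) ∈ δ MH) eq (toH-δ (H ≟₁ H) t))

  settled-K : ∀ {q qb} → toK (K ≟₂ K) q ≡ inj₁ qb → {P : Act (R₁ ⊎ R₂) Msg → Set} →
    (∀ l v → (inj₁ qb , l , v) ∈ δ MK → P l) → ∀ l v → (q , l , v) ∈ δ (compose (inj₂ K)) → P l
  settled-K eq P-gw l v t = P-gw l _ (subst (λ u → (u , l , _) ∈ δ MK) eq (toK-δ (K ≟₂ K) t))

lemma2 : {R₁ R₂ Msg : Set}
    (_≟₁_ : DecidableEquality R₁) (_≟₂_ : DecidableEquality R₂) →
    Finite R₁ → Finite R₂ → Finite Msg →
    (S₁ : System R₁ Msg) (S₂ : System R₂ Msg) →
    WfSystem S₁ → WfSystem S₂ →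
    (H : R₁) (K : R₂) →
    Compatible (S₁ H) (S₂ K) →
    let open Composition _≟₁_ _≟₂_ S₁ S₂ H K in
    (c : Config compose) →
    Reachable compose c →
    (∀ p p' → ch c p p' ≡ []) →
    ¬ FreshH (st c (inj₁ H)) →
    ¬ FreshK (st c (inj₂ K)) →
    ¬ Final (compose (inj₁ H)) (st c (inj₁ H)) →
    ¬ Final (compose (inj₂ K)) (st c (inj₂ K)) →
    ((∀ l q' → (st c (inj₁ H) , l , q') ∈ δ (compose (inj₁ H)) →
        ∃ λ a → l ≡ (inj₂ K , inj₁ H , rcv , a)) ×
     (∀ l q' → (st c (inj₂ K) , l , q') ∈ δ (compose (inj₂ K)) →
        ∃₂ λ s a → l ≡ (s , inj₂ K , rcv , a) × s ≢ inj₁ H))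
    ⊎
    ((∀ l q' → (st c (inj₂ K) , l , q') ∈ δ (compose (inj₂ K)) →
        ∃ λ a → l ≡ (inj₁ H , inj₂ K , rcv , a)) ×
     (∀ l q' → (st c (inj₁ H) , l , q') ∈ δ (compose (inj₁ H)) →
        ∃₂ λ s a → l ≡ (s , inj₁ H , rcv , a) × s ≢ inj₂ K))
lemma2 {R₁} {R₂} {Msg} _≟₁_ _≟₂_ _ _ _ S₁ S₂ _ _ H K compat c reachable empty ¬freshH ¬freshK _ _ =
  Sum.map (λ (sendingA , receivingB) →
             settled-H atH (GH.gw-sending (moded-rename inj₁ {S₁ H} sendingA)) ,
             settled-K atK (GK.gw-receiving avoidsB (moded-rename inj₂ {S₂ K} receivingB)))
          (λ (receivingA , sendingB) →
             settled-K atK (GK.gw-sending (moded-rename inj₂ {S₂ K} sendingB)) ,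
             settled-H atH (GH.gw-receiving avoidsA (moded-rename inj₁ {S₁ H} receivingA)))
          (rest-modes nmA detA mirBA at-rest)
  where
  open Composed _≟₁_ _≟₂_ S₁ S₂ H K compat

  settledH : ∃ λ qa → hs c ≡ inj₁ qa
  settledH = toH-settled (H ≟₁ H) ¬freshH

  settledK : ∃ λ qb → ks c ≡ inj₁ qb
  settledK = toK-settled (K ≟₂ K) ¬freshK

  qa : Q (S₁ H)
  qa = proj₁ settledH

  qb : Q (S₂ K)
  qb = proj₁ settledK

  atH : hs c ≡ inj₁ qa
  atH = proj₂ settledH

  atK : ks c ≡ inj₁ qb
  atK = proj₂ settledK

  at-rest : Sync (S₁ H) (S₂ K) qa [] qb []
  at-rest = SyncAt-cong atH atK (empty k a) (empty a k) (sync-reachable reachable)
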